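{- Let $\mathcal{G}$ be a finite simple undirected graph. If $H_1$ and $H_2$ are connected proper F-twins in $\mathcal{G}$, then either $H_1$ and $H_2$ are connected components of $\mathcal{G}$, or $d(H_1,H_2)=2$. In either case, $H_1$ and $H_2$ are not adjacent to each other (no vertex of $H_1$ is adjacent to a vertex of $H_2$).
   Context: All graphs are finite, undirected, without loops or parallel edges. For a vertex $u$, $\mathcal{N}(u)$ denotes the set of vertices adjacent to $u$. Two induced subgraphs $H_1,H_2$ of $\mathcal{G}$ with vertex sets $V_1,V_2$ are called F-twins if there is a graph isomorphism $\varphi:V_1\to V_2$ between $H_1$ and $H_2$ such that $\mathcal{N}(u)-V_1=\mathcal{N}(\varphi(u))-V_2$ for all $u\in V_1$; they are proper F-twins if moreover $H_1\neq H_2$. The distance $d(u,v)$ is the length of a shortest path joining $u,v$; for disjoint subgraphs $A,B$ in the same connected component, $d(A,B)=\min\{d(u,v): u\in A, v\in B\}$. -}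

module Defs where

open import Data.Nat using (ℕ; zero; suc; _≤_; _<_)
open import Data.Bool using (Bool; true; false)
open import Data.Fin using (Fin)
open import Data.Fin.Subset using (Subset; _∈_; _∉_; _─_; ⊤)
open import Data.Vec using (tabulate)
open import Data.Product using (Σ; ∃; ∃-syntax; _×_; _,_; proj₁)
open import Function.Bundles using (_↔_; Inverse)
open import Relation.Binary.PropositionalEquality using (_≡_)
open import Relation.Nullary using (¬_)

record Graph : Set where
  field
    n      : ℕ
    adj    : Fin n → Fin n → Bool
    sym    : ∀ u v → adj u v ≡ adj v u
    irrefl : ∀ u → adj u u ≡ false
open Graph public

-- Induced subgraphs are given by their vertex sets.
VSet : Graph → Set
VSet G = Subset (n G)

Nbhd : (G : Graph) → Fin (n G) → VSet G
Nbhd G u = tabulate (adj G u)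

data WalkIn (G : Graph) (S : VSet G) : Fin (n G) → Fin (n G) → ℕ → Set where
  here : ∀ {u} → u ∈ S → WalkIn G S u u zero
  step : ∀ {u w v k} → u ∈ S → adj G u w ≡ true → WalkIn G S w v k → WalkIn G S u v (suc k)

Walk : (G : Graph) → Fin (n G) → Fin (n G) → ℕ → Set
Walk G = WalkIn G ⊤

Dist : (G : Graph) → Fin (n G) → Fin (n G) → ℕ → Set
Dist G u v k = Walk G u v k × (∀ m → m < k → ¬ Walk G u v m)

SetDist : (G : Graph) → VSet G → VSet G → ℕ → Set
SetDist G A B k =
  (∃[ u ] ∃[ v ] (u ∈ A × v ∈ B × Dist G u v k)) ×
  (∀ u v m → u ∈ A → v ∈ B → Walk G u v m → k ≤ m)

Connected : (G : Graph) → VSet G → Set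
Connected G V = (∃[ u ] u ∈ V) × (∀ u v → u ∈ V → v ∈ V → ∃[ k ] WalkIn G V u v k)

IsComponent : (G : Graph) → VSet G → Set
IsComponent G V = Connected G V × (∀ u v → u ∈ V → adj G u v ≡ true → v ∈ V)

FTwins : (G : Graph) → VSet G → VSet G → Set
FTwins G V₁ V₂ =
  Σ ((Σ (Fin (n G)) (_∈ V₁)) ↔ (Σ (Fin (n G)) (_∈ V₂))) λ φ →
    (∀ x y → adj G (proj₁ x) (proj₁ y) ≡ adj G (proj₁ (Inverse.to φ x)) (proj₁ (Inverse.to φ y))) ×
    (∀ x → (Nbhd G (proj₁ x) ─ V₁) ≡ (Nbhd G (proj₁ (Inverse.to φ x)) ─ V₂))

ProperFTwins : (G : Graph) → VSet G → VSet G → Set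
ProperFTwins G V₁ V₂ = FTwins G V₁ V₂ × ¬ (V₁ ≡ V₂)

-- The neighbourhood condition of F-twins says that an edge leaving V₁ at u reaches a vertex
-- outside V₂ that is adjacent to φ(u), and symmetrically. Hence no edge runs from V₁ into
-- V₂ ─ V₁ or from V₂ into V₁ ─ V₂, so a connected V₂ meeting V₁ lies inside V₁ and vice
-- versa; proper twins are therefore disjoint and non-adjacent, and every walk between them has
-- length at least 2. If some edge u x leaves V₁, then u x φ(u) is a walk of length 2 from V₁ to
-- V₂; otherwise V₁ is closed under adjacency, hence so is V₂, and both are components.
module Submission where

open import Defs hiding (sym)
open import Data.Bool using (true; false; _≟_)
open import Data.Bool.Properties using (¬-not)
open import Data.Empty using (⊥; ⊥-elim)
open import Data.Fin using (Fin)
open import Data.Fin.Properties using (any?)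
open import Data.Fin.Subset using (Subset; _∈_; _∉_; _─_; _⊆_; outside)
open import Data.Fin.Subset.Properties using (_∈?_; ∈⊤; ⊆-antisym; x∈p∧x∉q⇒x∈p─q; p─q⊆p)
open import Data.Nat using (_≤_; s≤s; z≤n)
open import Data.Nat.Properties using (<⇒≱)
open import Data.Product using (∃-syntax; _×_; _,_; proj₁; proj₂)
open import Data.Sum using (_⊎_; inj₁; inj₂)
open import Data.Vec using (_∷_; here; there; tabulate)
open import Data.Vec.Properties using (lookup∘tabulate; []=⇒lookup; lookup⇒[]=)
open import Function.Bundles using (Inverse)
open import Relation.Binary.PropositionalEquality using (_≡_; _≢_; refl; sym; trans; cong; subst)
open import Relation.Nullary using (yes; no)
open import Relation.Nullary.Decidable using (_×-dec_; ¬?)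

x∈p─q⇒x∉q : ∀ {m} {x : Fin m} (p q : Subset m) → x ∈ p ─ q → x ∉ q
x∈p─q⇒x∉q (_ ∷ p) (outside ∷ q) here      ()
x∈p─q⇒x∉q (_ ∷ p) (_ ∷ q)       (there x∈) (there x∈q) = x∈p─q⇒x∉q p q x∈ x∈q

module _ (G : Graph) where

  x∈Nbhd⁺ : ∀ {u x} → adj G u x ≡ true → x ∈ Nbhd G u
  x∈Nbhd⁺ {u} {x} ux = lookup⇒[]= x _ (trans (lookup∘tabulate (adj G u) x) ux)

  x∈Nbhd⁻ : ∀ {u x} → x ∈ Nbhd G u → adj G u x ≡ true
  x∈Nbhd⁻ {u} {x} x∈ = trans (sym (lookup∘tabulate (adj G u) x)) ([]=⇒lookup x∈)

  outer-neighbour-transfer : ∀ {u u′ y} {A B : VSet G} →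
    Nbhd G u ─ A ≡ Nbhd G u′ ─ B → adj G u y ≡ true → y ∉ A → adj G u′ y ≡ true × y ∉ B
  outer-neighbour-transfer {u′ = u′} {B = B} eq uy y∉A =
    x∈Nbhd⁻ (p─q⊆p (Nbhd G u′) B y∈) , x∈p─q⇒x∉q (Nbhd G u′) B y∈
    where y∈ = subst (_ ∈_) eq (x∈p∧x∉q⇒x∈p─q (x∈Nbhd⁺ uy) y∉A)

  OuterEdge : VSet G → Fin (n G) → Fin (n G) → Set
  OuterEdge V u x = u ∈ V × x ∉ V × adj G u x ≡ true

  Closed : VSet G → Set
  Closed V = ∀ u v → u ∈ V → adj G u v ≡ true → v ∈ V

  closed⊎outerEdge : (V : VSet G) → Closed V ⊎ ∃[ u ] ∃[ x ] OuterEdge V u x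
  closed⊎outerEdge V with any? (λ u → any? (λ x → u ∈? V ×-dec ¬? (x ∈? V) ×-dec adj G u x ≟ true))
  ... | yes edge = inj₂ edge
  ... | no ¬edge = inj₁ closed
    where
    closed : Closed V
    closed u v u∈ uv with v ∈? V
    ... | yes v∈ = v∈
    ... | no v∉ = ⊥-elim (¬edge (u , v , u∈ , v∉ , uv))

  NoEdgeInto : VSet G → VSet G → Set
  NoEdgeInto A B = ∀ {x y} → x ∈ A → y ∈ B → y ∉ A → adj G x y ≡ true → ⊥

  walkIn-source∈ : ∀ {S : VSet G} {u v k} → WalkIn G S u v k → u ∈ S
  walkIn-source∈ (here u∈) = u∈
  walkIn-source∈ (step u∈ _ _) = u∈

  walkIn-target∈ : ∀ {A B : VSet G} {u v k} →
    NoEdgeInto A B → WalkIn G B u v k → u ∈ A → v ∈ A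
  walkIn-target∈ _ (here _) u∈ = u∈
  walkIn-target∈ {A} noEdge (step {w = w} _ uw rest) u∈ with w ∈? A
  ... | yes w∈ = walkIn-target∈ noEdge rest w∈
  ... | no w∉ = ⊥-elim (noEdge u∈ (walkIn-source∈ rest) w∉ uw)

  connected-meets⇒⊆ : ∀ {A B : VSet G} {w} →
    NoEdgeInto A B → Connected G B → w ∈ A → w ∈ B → B ⊆ A
  connected-meets⇒⊆ noEdge (_ , walks) w∈A w∈B {z} z∈B =
    walkIn-target∈ noEdge (proj₂ (walks _ z w∈B z∈B)) w∈A

  walk-length≥2 : ∀ {u v m} → u ≢ v → adj G u v ≡ false → Walk G u v m → 2 ≤ m
  walk-length≥2 u≢v _ (here _) = ⊥-elim (u≢v refl)
  walk-length≥2 _ ¬uv (step _ uv (here _)) with () ← trans (sym uv) ¬uv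
  walk-length≥2 _ _ (step _ _ (step _ _ _)) = s≤s (s≤s z≤n)

module FTwinProperties (G : Graph) {V₁ V₂ : VSet G} (twins : FTwins G V₁ V₂) where

  open Inverse (proj₁ twins)

  twin₁ : ∀ {u} → u ∈ V₁ → Fin (n G)
  twin₁ u∈ = proj₁ (to (_ , u∈))

  twin₁∈V₂ : ∀ {u} (u∈ : u ∈ V₁) → twin₁ u∈ ∈ V₂
  twin₁∈V₂ u∈ = proj₂ (to (_ , u∈))

  twin₂ : ∀ {u} → u ∈ V₂ → Fin (n G)
  twin₂ u∈ = proj₁ (from (_ , u∈))

  twin₂∈V₁ : ∀ {u} (u∈ : u ∈ V₂) → twin₂ u∈ ∈ V₁
  twin₂∈V₁ u∈ = proj₂ (from (_ , u∈))

  outer-neighbour₁ : ∀ {u y} (u∈ : u ∈ V₁) →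
    adj G u y ≡ true → y ∉ V₁ → adj G (twin₁ u∈) y ≡ true × y ∉ V₂
  outer-neighbour₁ u∈ = outer-neighbour-transfer G (proj₂ (proj₂ twins) (_ , u∈))

  outer-neighbour₂ : ∀ {u y} (u∈ : u ∈ V₂) →
    adj G u y ≡ true → y ∉ V₂ → adj G (twin₂ u∈) y ≡ true × y ∉ V₁
  outer-neighbour₂ u∈ = outer-neighbour-transfer G (sym (trans
    (proj₂ (proj₂ twins) (from (_ , u∈)))
    (cong (λ x → Nbhd G (proj₁ x) ─ V₂) (inverseˡ refl))))

  noEdgeInto₁₂ : NoEdgeInto G V₁ V₂
  noEdgeInto₁₂ x∈ y∈ y∉ xy = proj₂ (outer-neighbour₁ x∈ xy y∉) y∈

  noEdgeInto₂₁ : NoEdgeInto G V₂ V₁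
  noEdgeInto₂₁ x∈ y∈ y∉ xy = proj₂ (outer-neighbour₂ x∈ xy y∉) y∈

  closed₁⇒closed₂ : Closed G V₁ → Closed G V₂
  closed₁⇒closed₂ closed₁ u v u∈ uv with v ∈? V₂
  ... | yes v∈ = v∈
  ... | no v∉ with outer-neighbour₂ u∈ uv v∉
  ...   | twin-v , v∉V₁ = ⊥-elim (v∉V₁ (closed₁ _ v (twin₂∈V₁ u∈) twin-v))

  module Proper (conn₁ : Connected G V₁) (conn₂ : Connected G V₂) (V₁≢V₂ : V₁ ≢ V₂) where

    disjoint : ∀ {u} → u ∈ V₁ → u ∈ V₂ → ⊥
    disjoint u∈₁ u∈₂ = V₁≢V₂ (⊆-antisym
      (connected-meets⇒⊆ G noEdgeInto₂₁ conn₁ u∈₂ u∈₁)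
      (connected-meets⇒⊆ G noEdgeInto₁₂ conn₂ u∈₁ u∈₂))

    nonadjacent : ∀ {u v} → u ∈ V₁ → v ∈ V₂ → adj G u v ≡ false
    nonadjacent {v = v} u∈ v∈ = ¬-not ¬uv
      where
      ¬uv : adj G _ v ≢ true
      ¬uv uv with v ∈? V₁
      ... | yes v∈₁ = disjoint v∈₁ v∈
      ... | no v∉₁ = noEdgeInto₁₂ u∈ v∈ v∉₁ uv

    walk-length≥2₁₂ : ∀ {u v m} → u ∈ V₁ → v ∈ V₂ → Walk G u v m → 2 ≤ m
    walk-length≥2₁₂ u∈ v∈ = walk-length≥2 G (λ { refl → disjoint u∈ v∈ }) (nonadjacent u∈ v∈)

    outerEdge⇒setDist₂ : ∀ {u x} → OuterEdge G V₁ u x → SetDist G V₁ V₂ 2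
    outerEdge⇒setDist₂ {u} {x} (u∈ , x∉ , ux) =
      (u , twin₁ u∈ , u∈ , twin₁∈V₂ u∈ , path ,
        λ m m<2 walk → <⇒≱ m<2 (walk-length≥2₁₂ u∈ (twin₁∈V₂ u∈) walk)) ,
      λ _ _ _ → walk-length≥2₁₂
      where
      path : Walk G u (twin₁ u∈) 2
      path = step ∈⊤ ux (step ∈⊤ (trans (Graph.sym G x _) twin-x) (here ∈⊤))
        where twin-x = proj₁ (outer-neighbour₁ u∈ ux x∉)

corollary2 : (G : Graph) (V₁ V₂ : VSet G) →
    Connected G V₁ → Connected G V₂ → ProperFTwins G V₁ V₂ →
    ((IsComponent G V₁ × IsComponent G V₂) ⊎ SetDist G V₁ V₂ 2) ×
    (∀ u v → u ∈ V₁ → v ∈ V₂ → adj G u v ≡ false)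
corollary2 G V₁ V₂ conn₁ conn₂ (twins , V₁≢V₂) = components⊎distance2 , λ _ _ → nonadjacent
  where
  open FTwinProperties G twins
  open Proper conn₁ conn₂ V₁≢V₂

  components⊎distance2 : (IsComponent G V₁ × IsComponent G V₂) ⊎ SetDist G V₁ V₂ 2
  components⊎distance2 with closed⊎outerEdge G V₁
  ... | inj₁ closed₁ = inj₁ ((conn₁ , closed₁) , (conn₂ , closed₁⇒closed₂ closed₁))
  ... | inj₂ (_ , _ , outer) = inj₂ (outerEdge⇒setDist₂ outer)
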